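{- An algebra $\mathbf L=\langle L,\land,\lor,0,1\rangle$ is a bounded distributive bisemilattice if and only if it is isomorphic to a structure $\langle X,\cdot,+,\bot,\top\rangle$ of the following form: - $X$ is a family of sets closed under finite intersections with greatest element $\overline 1$; - $Y$ is a family of sets closed under finite unions with least element $\overline 0$; - $\theta:X\to Y$ is a bijection such that, for all $A,B,C\in X$, $A\cap\theta^{ -1}(\theta(B)\cup\theta(C))=\theta^{ -1}(\theta(A\cap B)\cup\theta(A\cap C))$, and, for all $P,Q,R\in Y$, $P\cup\theta(\theta^{ -1}(Q)\cap\theta^{ -1}(R))=\theta(\theta^{ -1}(P\cup Q)\cap\theta^{ -1}(P\cup R))$; - $A\cdot B=A\cap B$, $A+B=\theta^{ -1}(\theta(A)\cup\theta(B))$, $\bot=\theta^{ -1}(\overline0)$ and $\top=\overline1$.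
   Context: A bounded distributive bisemilattice is an algebra $\langle L,\land,\lor,0,1\rangle$ such that: - $\land$ and $\lor$ are idempotent, commutative and associative; - each of $\land$, $\lor$ distributes over the other; - $x\land1=x$ and $x\lor0=x$ for all $x$. -}

module Defs where

open import Level using (0ℓ)
open import Data.Product using (Σ; _×_; _,_; proj₁; proj₂)
open import Relation.Unary using (Pred; _⊆_; _∩_; _∪_; _≐_)
open import Relation.Binary.PropositionalEquality using (_≡_)

record IsBDB {L : Set} (_∧_ _∨_ : L → L → L) (𝟘 𝟙 : L) : Set where
  field
    ∧-idem   : ∀ x → x ∧ x ≡ x
    ∨-idem   : ∀ x → x ∨ x ≡ x
    ∧-comm   : ∀ x y → x ∧ y ≡ y ∧ x
    ∨-comm   : ∀ x y → x ∨ y ≡ y ∨ x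
    ∧-assoc  : ∀ x y z → (x ∧ y) ∧ z ≡ x ∧ (y ∧ z)
    ∨-assoc  : ∀ x y z → (x ∨ y) ∨ z ≡ x ∨ (y ∨ z)
    ∧-distrib-∨ : ∀ x y z → x ∧ (y ∨ z) ≡ (x ∧ y) ∨ (x ∧ z)
    ∨-distrib-∧ : ∀ x y z → x ∨ (y ∧ z) ≡ (x ∨ y) ∧ (x ∨ z)
    ∧-identity : ∀ x → x ∧ 𝟙 ≡ x
    ∨-identity : ∀ x → x ∨ 𝟘 ≡ x

-- Sets are predicates on a universe U, compared extensionally (_≐_).
-- A "family of sets" is a predicate on sets that respects _≐_.

Subset : Set → Set₁
Subset U = Pred U 0ℓ

Family : Set → Set₁
Family U = Pred (Subset U) 0ℓ

record SetSystem (U : Set) : Set₁ where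
  field
    X : Family U
    Y : Family U
    X-resp : ∀ {A B} → A ≐ B → X A → X B
    Y-resp : ∀ {P Q} → P ≐ Q → Y P → Y Q
    X-∩ : ∀ {A B} → X A → X B → X (A ∩ B)
    Y-∪ : ∀ {P Q} → Y P → Y Q → Y (P ∪ Q)
    1̄ : Subset U
    1̄∈X : X 1̄
    1̄-greatest : ∀ {A} → X A → A ⊆ 1̄
    0̄ : Subset U
    0̄∈Y : Y 0̄
    0̄-least : ∀ {P} → Y P → 0̄ ⊆ P

module SetSystemOps {U : Set} (S : SetSystem U) where
  open SetSystem S

  XC : Set₁
  XC = Σ (Subset U) X

  YC : Set₁
  YC = Σ (Subset U) Y

  _≈X_ : XC → XC → Set
  A ≈X B = proj₁ A ≐ proj₁ B

  _≈Y_ : YC → YC → Set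
  P ≈Y Q = proj₁ P ≐ proj₁ Q

  _∩X_ : XC → XC → XC
  (A , a) ∩X (B , b) = (A ∩ B) , X-∩ a b

  _∪Y_ : YC → YC → YC
  (P , p) ∪Y (Q , q) = (P ∪ Q) , Y-∪ p q

  1̄X : XC
  1̄X = 1̄ , 1̄∈X

  0̄Y : YC
  0̄Y = 0̄ , 0̄∈Y

record Theta {U : Set} (S : SetSystem U) : Set₁ where
  open SetSystemOps S
  field
    θ   : XC → YC
    θ⁻¹ : YC → XC
    θ-cong   : ∀ {A B} → A ≈X B → θ A ≈Y θ B
    θ⁻¹-cong : ∀ {P Q} → P ≈Y Q → θ⁻¹ P ≈X θ⁻¹ Q
    θ⁻¹∘θ : ∀ A → θ⁻¹ (θ A) ≈X A
    θ∘θ⁻¹ : ∀ P → θ (θ⁻¹ P) ≈Y P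
    cond-X : ∀ A B C →
      (A ∩X θ⁻¹ (θ B ∪Y θ C)) ≈X θ⁻¹ (θ (A ∩X B) ∪Y θ (A ∩X C))
    cond-Y : ∀ P Q R →
      (P ∪Y θ (θ⁻¹ Q ∩X θ⁻¹ R)) ≈Y θ (θ⁻¹ (P ∪Y Q) ∩X θ⁻¹ (P ∪Y R))

module ThetaOps {U : Set} {S : SetSystem U} (T : Theta S) where
  open SetSystemOps S public
  open Theta T

  _·_ : XC → XC → XC
  A · B = A ∩X B

  _+_ : XC → XC → XC
  A + B = θ⁻¹ (θ A ∪Y θ B)

  ⊥X : XC
  ⊥X = θ⁻¹ 0̄Y

  ⊤X : XC
  ⊤X = 1̄X

record Iso {L : Set} (_∧_ _∨_ : L → L → L) (𝟘 𝟙 : L)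
           {U : Set} {S : SetSystem U} (T : Theta S) : Set₁ where
  open ThetaOps T
  field
    f : L → XC
    f-injective  : ∀ {x y} → f x ≈X f y → x ≡ y
    f-surjective : ∀ A → Σ L (λ x → f x ≈X A)
    f-∧ : ∀ x y → f (x ∧ y) ≈X (f x · f y)
    f-∨ : ∀ x y → f (x ∨ y) ≈X (f x + f y)
    f-𝟘 : f 𝟘 ≈X ⊥X
    f-𝟙 : f 𝟙 ≈X ⊤X

Representable : {L : Set} (_∧_ _∨_ : L → L → L) (𝟘 𝟙 : L) → Set₁
Representable _∧_ _∨_ 𝟘 𝟙 =
  Σ Set λ U → Σ (SetSystem U) λ S → Σ (Theta S) λ T → Iso _∧_ _∨_ 𝟘 𝟙 T

-- (⇒) Given a bounded distributive bisemilattice L, send x to its principal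
-- ∧-down-set  ↓∧ x = {y | y ∧ x = y}  and to the complement of its principal
-- ∨-down-set  ∁ ↓∨ x = {z | z ∨ x ≠ z}.  In any semilattice the principal
-- down-set map is injective and turns the operation into ∩; by De Morgan
-- (classical logic) the complemented map is injective and turns ∨ into ∪.
-- So X = the sets ↓∧ x, Y = the sets ∁ ↓∨ x, and θ(↓∧ x) = ∁ ↓∨ x is a
-- bijection; both mixed conditions are the two distributive laws of L read
-- through these injective codings, and x ↦ ↓∧ x is the isomorphism.
--
-- (⇐) Conversely the operations ⟨X, ·, +, ⊥, ⊤⟩ built from any set system
-- with such a θ satisfy every bisemilattice law up to extensional equality
-- (the two distributive laws being exactly cond-X and cond-Y), and an
-- injective homomorphism into such an algebra reflects these laws.
module Submission where

open import Defs
open import Level using (0ℓ; suc)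
open import Axiom.ExcludedMiddle using (ExcludedMiddle)
open import Axiom.DoubleNegationElimination using (DoubleNegationElimination; em⇒dne)
open import Function.Base using (_∘_)
open import Function.Bundles using (_⇔_; mk⇔)
open import Data.Product using (Σ; _,_; proj₁; proj₂)
open import Data.Sum using (inj₁; inj₂; [_,_]′; swap)
open import Data.Empty using (⊥-elim)
open import Relation.Nullary using (yes; no)
open import Relation.Unary using (_⊆_; _∩_; _∪_; _≐_; ∁)
open import Relation.Unary.Properties using (≐-refl; ≐-sym; ≐-trans)
open import Relation.Binary.Bundles using (Setoid)
open import Relation.Binary.PropositionalEquality
  using (_≡_; refl; sym; trans; cong; module ≡-Reasoning)
import Relation.Binary.Reasoning.Setoid as SetoidReasoning

module SetAlgebra {U : Set} where

  ∩-cong : {A A′ B B′ : Subset U} → A ≐ A′ → B ≐ B′ → (A ∩ B) ≐ (A′ ∩ B′)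
  ∩-cong (p , p′) (q , q′) = (λ (a , b) → p a , q b) , (λ (a , b) → p′ a , q′ b)

  ∪-cong : {A A′ B B′ : Subset U} → A ≐ A′ → B ≐ B′ → (A ∪ B) ≐ (A′ ∪ B′)
  ∪-cong (p , p′) (q , q′) = [ inj₁ ∘ p , inj₂ ∘ q ]′ , [ inj₁ ∘ p′ , inj₂ ∘ q′ ]′

  ∁-cong : {A B : Subset U} → A ≐ B → ∁ A ≐ ∁ B
  ∁-cong (p , q) = (λ a∉A b∈B → a∉A (q b∈B)) , (λ b∉B a∈A → b∉B (p a∈A))

  ∩-idem : (A : Subset U) → (A ∩ A) ≐ A
  ∩-idem A = proj₁ , λ a → a , a

  ∪-idem : (A : Subset U) → (A ∪ A) ≐ A
  ∪-idem A = [ (λ a → a) , (λ a → a) ]′ , inj₁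

  ∩-comm : (A B : Subset U) → (A ∩ B) ≐ (B ∩ A)
  ∩-comm A B = (λ (a , b) → b , a) , (λ (b , a) → a , b)

  ∪-comm : (A B : Subset U) → (A ∪ B) ≐ (B ∪ A)
  ∪-comm A B = swap , swap

  ∩-assoc : (A B C : Subset U) → ((A ∩ B) ∩ C) ≐ (A ∩ (B ∩ C))
  ∩-assoc A B C = (λ ((a , b) , c) → a , b , c) , (λ (a , b , c) → (a , b) , c)

  ∪-assoc : (A B C : Subset U) → ((A ∪ B) ∪ C) ≐ (A ∪ (B ∪ C))
  ∪-assoc A B C = [ [ inj₁ , inj₂ ∘ inj₁ ]′ , inj₂ ∘ inj₂ ]′
                , [ inj₁ ∘ inj₁ , [ inj₁ ∘ inj₂ , inj₂ ]′ ]′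

  ∩-⊆ : {A B : Subset U} → A ⊆ B → (A ∩ B) ≐ A
  ∩-⊆ A⊆B = proj₁ , λ a → a , A⊆B a

  ∪-⊆ : {A B : Subset U} → A ⊆ B → (B ∪ A) ≐ B
  ∪-⊆ A⊆B = [ (λ b → b) , A⊆B ]′ , inj₁

  ∁-∩ : ExcludedMiddle 0ℓ → (A B : Subset U) → ∁ (A ∩ B) ≐ (∁ A ∪ ∁ B)
  ∁-∩ em A B = to , [ (λ a∉A (a , _) → a∉A a) , (λ b∉B (_ , b) → b∉B b) ]′
    where
    to : ∁ (A ∩ B) ⊆ (∁ A ∪ ∁ B)
    to {u} u∉A∩B with em {A u}
    ... | no  u∉A = inj₁ u∉A
    ... | yes u∈A = inj₂ (λ u∈B → u∉A∩B (u∈A , u∈B))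

  ∁-injective : DoubleNegationElimination 0ℓ → {A B : Subset U} → ∁ A ≐ ∁ B → A ≐ B
  ∁-injective dne (p , q) = (λ a → dne (λ b∉B → q b∉B a))
                          , (λ b → dne (λ a∉A → p a∉A b))

open SetAlgebra

members : {U : Set} → Family U → Setoid (suc 0ℓ) 0ℓ
members {U} F = record
  { Carrier       = Σ (Subset U) F
  ; _≈_           = λ A B → proj₁ A ≐ proj₁ B
  ; isEquivalence = record { refl = ≐-refl ; sym = ≐-sym ; trans = ≐-trans }
  }

module PrincipalDownSets {L : Set} (_∙_ : L → L → L)
  (idem  : ∀ x → x ∙ x ≡ x)
  (comm  : ∀ x y → x ∙ y ≡ y ∙ x)
  (assoc : ∀ x y z → (x ∙ y) ∙ z ≡ x ∙ (y ∙ z)) where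
  open ≡-Reasoning

  ↓_ : L → Subset L
  ↓ x = λ y → y ∙ x ≡ y

  ↓-∙ʳ : ∀ x y → ↓ (x ∙ y) ⊆ ↓ y
  ↓-∙ʳ x y {z} z≤xy = begin
    z ∙ y               ≡⟨ cong (_∙ y) (sym z≤xy) ⟩
    (z ∙ (x ∙ y)) ∙ y   ≡⟨ assoc z (x ∙ y) y ⟩
    z ∙ ((x ∙ y) ∙ y)   ≡⟨ cong (z ∙_) (assoc x y y) ⟩
    z ∙ (x ∙ (y ∙ y))   ≡⟨ cong (λ w → z ∙ (x ∙ w)) (idem y) ⟩
    z ∙ (x ∙ y)         ≡⟨ z≤xy ⟩
    z                   ∎

  ↓-∙ : ∀ x y → ↓ (x ∙ y) ≐ (↓ x ∩ ↓ y)
  ↓-∙ x y = (λ z≤xy → ↓-∙ʳ y x (subst-↓ (comm x y) z≤xy) , ↓-∙ʳ x y z≤xy)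
          , λ {z} (z≤x , z≤y) → begin
              z ∙ (x ∙ y)   ≡⟨ sym (assoc z x y) ⟩
              (z ∙ x) ∙ y   ≡⟨ cong (_∙ y) z≤x ⟩
              z ∙ y         ≡⟨ z≤y ⟩
              z             ∎
    where
    subst-↓ : ∀ {a b z} → a ≡ b → z ∙ a ≡ z → z ∙ b ≡ z
    subst-↓ {z = z} a≡b = trans (cong (z ∙_) (sym a≡b))

  ↓-injective : ∀ {x y} → ↓ x ≐ ↓ y → x ≡ y
  ↓-injective {x} {y} (x⊆y , y⊆x) = begin
    x       ≡⟨ sym (x⊆y (idem x)) ⟩
    x ∙ y   ≡⟨ comm x y ⟩
    y ∙ x   ≡⟨ y⊆x (idem y) ⟩
    y       ∎

module Image {L U : Set} (c : L → Subset U)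
  (c-injective : ∀ {x y} → c x ≐ c y → x ≡ y) where

  Im : Family U
  Im A = Σ L λ x → A ≐ c x

  Member : Set₁
  Member = Σ (Subset U) Im

  Im-resp : ∀ {A B} → A ≐ B → Im A → Im B
  Im-resp A≐B (x , A≐cx) = x , ≐-trans (≐-sym A≐B) A≐cx

  Im-closed : (_∙_ : L → L → L) (_⊙_ : Subset U → Subset U → Subset U) →
    (∀ {A A′ B B′} → A ≐ A′ → B ≐ B′ → (A ⊙ B) ≐ (A′ ⊙ B′)) →
    (∀ x y → c (x ∙ y) ≐ (c x ⊙ c y)) →
    ∀ {A B} → Im A → Im B → Im (A ⊙ B)
  Im-closed _∙_ _⊙_ ⊙-cong c-∙ (x , A≐cx) (y , B≐cy) =
    x ∙ y , ≐-trans (⊙-cong A≐cx B≐cy) (≐-sym (c-∙ x y))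

  code : Member → L
  code = proj₁ ∘ proj₂

  embed : L → Member
  embed x = c x , x , ≐-refl

  ≐⇒code≡ : (A B : Member) → proj₁ A ≐ proj₁ B → code A ≡ code B
  ≐⇒code≡ (A , x , A≐cx) (B , y , B≐cy) A≐B =
    c-injective (≐-trans (≐-sym A≐cx) (≐-trans A≐B B≐cy))

  code≡⇒≐ : (A B : Member) → code A ≡ code B → proj₁ A ≐ proj₁ B
  code≡⇒≐ (A , x , A≐cx) (B , .x , B≐cx) refl = ≐-trans A≐cx (≐-sym B≐cx)

module Representation (em : ExcludedMiddle 0ℓ) {L : Set}
  {_∧_ _∨_ : L → L → L} {𝟘 𝟙 : L} (B : IsBDB _∧_ _∨_ 𝟘 𝟙) where
  open IsBDB B

  module Meet = PrincipalDownSets _∧_ ∧-idem ∧-comm ∧-assoc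
  module Join = PrincipalDownSets _∨_ ∨-idem ∨-comm ∨-assoc

  D E : L → Subset L
  D = Meet.↓_
  E = ∁ ∘ Join.↓_

  E-∨ : ∀ x y → E (x ∨ y) ≐ (E x ∪ E y)
  E-∨ x y = ≐-trans (∁-cong (Join.↓-∙ x y)) (∁-∩ em (Join.↓ x) (Join.↓ y))

  E-injective : ∀ {x y} → E x ≐ E y → x ≡ y
  E-injective = Join.↓-injective ∘ ∁-injective (em⇒dne em)

  module DX = Image D Meet.↓-injective
  module EY = Image E E-injective

  S : SetSystem L
  S = record
    { X          = DX.Im
    ; Y          = EY.Im
    ; X-resp     = DX.Im-resp
    ; Y-resp     = EY.Im-resp
    ; X-∩        = DX.Im-closed _∧_ _∩_ ∩-cong Meet.↓-∙
    ; Y-∪        = EY.Im-closed _∨_ _∪_ ∪-cong E-∨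
    ; 1̄          = D 𝟙
    ; 1̄∈X        = 𝟙 , ≐-refl
    ; 1̄-greatest = λ _ {y} _ → ∧-identity y
    ; 0̄          = E 𝟘
    ; 0̄∈Y        = 𝟘 , ≐-refl
    ; 0̄-least    = λ _ {z} z∉↓𝟘 → ⊥-elim (z∉↓𝟘 (∨-identity z))
    }

  open SetSystemOps S

  -- θ(↓∧ x) = ∁ ↓∨ x, a bijection since both families are coded by L.
  θ : XC → YC
  θ = EY.embed ∘ DX.code

  θ⁻¹ : YC → XC
  θ⁻¹ = DX.embed ∘ EY.code

  T : Theta S
  T = record
    { θ        = θ
    ; θ⁻¹      = θ⁻¹
    ; θ-cong   = λ {A} {B} A≐B →
        EY.code≡⇒≐ (θ A) (θ B) (DX.≐⇒code≡ A B A≐B)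
    ; θ⁻¹-cong = λ {P} {Q} P≐Q →
        DX.code≡⇒≐ (θ⁻¹ P) (θ⁻¹ Q) (EY.≐⇒code≡ P Q P≐Q)
    ; θ⁻¹∘θ    = λ A → DX.code≡⇒≐ (θ⁻¹ (θ A)) A refl
    ; θ∘θ⁻¹    = λ P → EY.code≡⇒≐ (θ (θ⁻¹ P)) P refl
    ; cond-X   = λ A B C →
        DX.code≡⇒≐ (A ∩X θ⁻¹ (θ B ∪Y θ C)) (θ⁻¹ (θ (A ∩X B) ∪Y θ (A ∩X C)))
          (∧-distrib-∨ (DX.code A) (DX.code B) (DX.code C))
    ; cond-Y   = λ P Q R →
        EY.code≡⇒≐ (P ∪Y θ (θ⁻¹ Q ∩X θ⁻¹ R)) (θ (θ⁻¹ (P ∪Y Q) ∩X θ⁻¹ (P ∪Y R)))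
          (∨-distrib-∧ (EY.code P) (EY.code Q) (EY.code R))
    }

  -- x ↦ ↓∧ x is the isomorphism: it turns ∧ into ∩, and + , ⊥ , ⊤ are
  -- by construction the down-sets of ∨ , 𝟘 , 𝟙.
  I : Iso _∧_ _∨_ 𝟘 𝟙 T
  I = record
    { f            = DX.embed
    ; f-injective  = Meet.↓-injective
    ; f-surjective = λ A → DX.code A , ≐-sym (proj₂ (proj₂ A))
    ; f-∧          = Meet.↓-∙
    ; f-∨          = λ x y → ≐-refl
    ; f-𝟘          = ≐-refl
    ; f-𝟙          = ≐-refl
    }

  representable : Representable _∧_ _∨_ 𝟘 𝟙
  representable = L , S , T , I

module RepresentedAlgebra {U : Set} {S : SetSystem U} (T : Theta S) where
  open SetSystem S
  open Theta T
  open ThetaOps T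

  +-cong : ∀ {A A′ B B′} → A ≈X A′ → B ≈X B′ → (A + B) ≈X (A′ + B′)
  +-cong A≈A′ B≈B′ = θ⁻¹-cong (∪-cong (θ-cong A≈A′) (θ-cong B≈B′))

  ·-idem : ∀ A → (A · A) ≈X A
  ·-idem A = ∩-idem (proj₁ A)

  +-idem : ∀ A → (A + A) ≈X A
  +-idem A = ≐-trans (θ⁻¹-cong (∪-idem (proj₁ (θ A)))) (θ⁻¹∘θ A)

  ·-comm : ∀ A B → (A · B) ≈X (B · A)
  ·-comm A B = ∩-comm (proj₁ A) (proj₁ B)

  +-comm : ∀ A B → (A + B) ≈X (B + A)
  +-comm A B = θ⁻¹-cong (∪-comm (proj₁ (θ A)) (proj₁ (θ B)))

  ·-assoc : ∀ A B C → ((A · B) · C) ≈X (A · (B · C))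
  ·-assoc A B C = ∩-assoc (proj₁ A) (proj₁ B) (proj₁ C)

  θ-+ : ∀ A B → θ (A + B) ≈Y (θ A ∪Y θ B)
  θ-+ A B = θ∘θ⁻¹ (θ A ∪Y θ B)

  +-assoc : ∀ A B C → ((A + B) + C) ≈X (A + (B + C))
  +-assoc A B C = θ⁻¹-cong unions-assoc
    where
    open SetoidReasoning (members Y)
    unions-assoc : (θ (A + B) ∪Y θ C) ≈Y (θ A ∪Y θ (B + C))
    unions-assoc = begin
      θ (A + B) ∪Y θ C              ≈⟨ ∪-cong (θ-+ A B) ≐-refl ⟩
      (θ A ∪Y θ B) ∪Y θ C           ≈⟨ ∪-assoc _ _ _ ⟩
      θ A ∪Y (θ B ∪Y θ C)           ≈⟨ ∪-cong ≐-refl (≐-sym (θ-+ B C)) ⟩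
      θ A ∪Y θ (B + C)              ∎

  ·-distrib-+ : ∀ A B C → (A · (B + C)) ≈X ((A · B) + (A · C))
  ·-distrib-+ = cond-X

  +-distrib-· : ∀ A B C → (A + (B · C)) ≈X ((A + B) · (A + C))
  +-distrib-· A B C = begin
    θ⁻¹ (θ A ∪Y θ (B · C))
      ≈⟨ θ⁻¹-cong (∪-cong ≐-refl (θ-cong (∩-cong (≐-sym (θ⁻¹∘θ B)) (≐-sym (θ⁻¹∘θ C))))) ⟩
    θ⁻¹ (θ A ∪Y θ (θ⁻¹ (θ B) · θ⁻¹ (θ C)))
      ≈⟨ θ⁻¹-cong (cond-Y (θ A) (θ B) (θ C)) ⟩
    θ⁻¹ (θ ((A + B) · (A + C)))
      ≈⟨ θ⁻¹∘θ _ ⟩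
    (A + B) · (A + C) ∎
    where open SetoidReasoning (members X)

  ·-identity : ∀ A → (A · ⊤X) ≈X A
  ·-identity A = ∩-⊆ (1̄-greatest (proj₂ A))

  +-identity : ∀ A → (A + ⊥X) ≈X A
  +-identity A = begin
    θ⁻¹ (θ A ∪Y θ (θ⁻¹ 0̄Y)) ≈⟨ θ⁻¹-cong (∪-cong ≐-refl (θ∘θ⁻¹ 0̄Y)) ⟩
    θ⁻¹ (θ A ∪Y 0̄Y)         ≈⟨ θ⁻¹-cong (∪-⊆ (0̄-least (proj₂ (θ A)))) ⟩
    θ⁻¹ (θ A)               ≈⟨ θ⁻¹∘θ A ⟩
    A                       ∎
    where open SetoidReasoning (members X)

module Transfer {L : Set} {_∧_ _∨_ : L → L → L} {𝟘 𝟙 : L}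
  {U : Set} {S : SetSystem U} {T : Theta S} (I : Iso _∧_ _∨_ 𝟘 𝟙 T) where
  open SetSystem S
  open ThetaOps T
  open RepresentedAlgebra T
  open Iso I
  open SetoidReasoning (members X)

  ∧-idem : ∀ x → x ∧ x ≡ x
  ∧-idem x = f-injective (≐-trans (f-∧ x x) (·-idem (f x)))

  ∨-idem : ∀ x → x ∨ x ≡ x
  ∨-idem x = f-injective (≐-trans (f-∨ x x) (+-idem (f x)))

  ∧-comm : ∀ x y → x ∧ y ≡ y ∧ x
  ∧-comm x y = f-injective (begin
    f (x ∧ y)   ≈⟨ f-∧ x y ⟩
    f x · f y   ≈⟨ ·-comm (f x) (f y) ⟩
    f y · f x   ≈⟨ f-∧ y x ⟨
    f (y ∧ x)   ∎)

  ∨-comm : ∀ x y → x ∨ y ≡ y ∨ x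
  ∨-comm x y = f-injective (begin
    f (x ∨ y)   ≈⟨ f-∨ x y ⟩
    f x + f y   ≈⟨ +-comm (f x) (f y) ⟩
    f y + f x   ≈⟨ f-∨ y x ⟨
    f (y ∨ x)   ∎)

  ∧-assoc : ∀ x y z → (x ∧ y) ∧ z ≡ x ∧ (y ∧ z)
  ∧-assoc x y z = f-injective (begin
    f ((x ∧ y) ∧ z)       ≈⟨ ≐-trans (f-∧ (x ∧ y) z) (∩-cong (f-∧ x y) ≐-refl) ⟩
    (f x · f y) · f z     ≈⟨ ·-assoc (f x) (f y) (f z) ⟩
    f x · (f y · f z)     ≈⟨ ≐-trans (f-∧ x (y ∧ z)) (∩-cong ≐-refl (f-∧ y z)) ⟨
    f (x ∧ (y ∧ z))       ∎)

  ∨-assoc : ∀ x y z → (x ∨ y) ∨ z ≡ x ∨ (y ∨ z)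
  ∨-assoc x y z = f-injective (begin
    f ((x ∨ y) ∨ z)       ≈⟨ ≐-trans (f-∨ (x ∨ y) z) (+-cong (f-∨ x y) ≐-refl) ⟩
    (f x + f y) + f z     ≈⟨ +-assoc (f x) (f y) (f z) ⟩
    f x + (f y + f z)     ≈⟨ ≐-trans (f-∨ x (y ∨ z)) (+-cong ≐-refl (f-∨ y z)) ⟨
    f (x ∨ (y ∨ z))       ∎)

  ∧-distrib-∨ : ∀ x y z → x ∧ (y ∨ z) ≡ (x ∧ y) ∨ (x ∧ z)
  ∧-distrib-∨ x y z = f-injective (begin
    f (x ∧ (y ∨ z))               ≈⟨ ≐-trans (f-∧ x (y ∨ z)) (∩-cong ≐-refl (f-∨ y z)) ⟩
    f x · (f y + f z)             ≈⟨ ·-distrib-+ (f x) (f y) (f z) ⟩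
    (f x · f y) + (f x · f z)     ≈⟨ ≐-trans (f-∨ (x ∧ y) (x ∧ z)) (+-cong (f-∧ x y) (f-∧ x z)) ⟨
    f ((x ∧ y) ∨ (x ∧ z))         ∎)

  ∨-distrib-∧ : ∀ x y z → x ∨ (y ∧ z) ≡ (x ∨ y) ∧ (x ∨ z)
  ∨-distrib-∧ x y z = f-injective (begin
    f (x ∨ (y ∧ z))               ≈⟨ ≐-trans (f-∨ x (y ∧ z)) (+-cong ≐-refl (f-∧ y z)) ⟩
    f x + (f y · f z)             ≈⟨ +-distrib-· (f x) (f y) (f z) ⟩
    (f x + f y) · (f x + f z)     ≈⟨ ≐-trans (f-∧ (x ∨ y) (x ∨ z)) (∩-cong (f-∨ x y) (f-∨ x z)) ⟨
    f ((x ∨ y) ∧ (x ∨ z))         ∎)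

  ∧-identity : ∀ x → x ∧ 𝟙 ≡ x
  ∧-identity x = f-injective (begin
    f (x ∧ 𝟙)   ≈⟨ ≐-trans (f-∧ x 𝟙) (∩-cong ≐-refl f-𝟙) ⟩
    f x · ⊤X    ≈⟨ ·-identity (f x) ⟩
    f x         ∎)

  ∨-identity : ∀ x → x ∨ 𝟘 ≡ x
  ∨-identity x = f-injective (begin
    f (x ∨ 𝟘)   ≈⟨ ≐-trans (f-∨ x 𝟘) (+-cong ≐-refl f-𝟘) ⟩
    f x + ⊥X    ≈⟨ +-identity (f x) ⟩
    f x         ∎)

  isBDB : IsBDB _∧_ _∨_ 𝟘 𝟙
  isBDB = record
    { ∧-idem = ∧-idem ; ∨-idem = ∨-idem ; ∧-comm = ∧-comm ; ∨-comm = ∨-comm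
    ; ∧-assoc = ∧-assoc ; ∨-assoc = ∨-assoc
    ; ∧-distrib-∨ = ∧-distrib-∨ ; ∨-distrib-∧ = ∨-distrib-∧
    ; ∧-identity = ∧-identity ; ∨-identity = ∨-identity
    }

theorem4p5 : ExcludedMiddle 0ℓ →
    (L : Set) (_∧_ _∨_ : L → L → L) (𝟘 𝟙 : L) →
    IsBDB _∧_ _∨_ 𝟘 𝟙 ⇔ Representable _∧_ _∨_ 𝟘 𝟙
theorem4p5 em L _∧_ _∨_ 𝟘 𝟙 =
  mk⇔ (Representation.representable em)
      (λ (_ , _ , _ , I) → Transfer.isBDB I)
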